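{- Let $N,k$ be positive integers. If there exists a matching in $Q_N$ which is a Breaker pairing strategy for $\mathcal{Q}(N,k)$, then for every positive integer $n\le N$ there exists a matching in $Q_n$ which is a Breaker pairing strategy for $\mathcal{Q}(n,k)$.
   Context: $Q_n$ is the hypercube graph on $\{0,1\}^n$ (vertices adjacent iff they differ in exactly one coordinate). A $k$-dimensional subcube of $Q_n$ is obtained by choosing $n-k$ coordinates and fixed values in $\{0,1\}$ for them, and taking all $2^k$ vectors agreeing with these fixed values. $\mathcal{Q}(n,k)$ is the hypergraph with vertex set $\{0,1\}^n$ whose edges are the $k$-dimensional subcubes of $Q_n$ (the Maker–Breaker game is played on it). A matching $M$ in $Q_n$ is a Breaker pairing strategy for $\mathcal{Q}(n,k)$ if every $k$-dimensional subcube of $Q_n$ contains both endpoints of at least one edge of $M$. -}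

module Defs where

open import Data.Nat using (ℕ; zero; suc; _+_)
open import Data.Bool using (Bool; _xor_; if_then_else_)
open import Data.Maybe using (Maybe; just; nothing)
open import Data.Vec using (Vec; []; _∷_; lookup)
open import Data.Fin using (Fin)
open import Data.List using (List; length)
import Data.List as L
open import Data.Product using (_×_; _,_; ∃; ∃-syntax; proj₁; proj₂)
open import Relation.Binary.PropositionalEquality using (_≡_; _≢_)

Vertex : ℕ → Set
Vertex n = Vec Bool n

hamming : ∀ {n} → Vertex n → Vertex n → ℕ
hamming [] [] = 0
hamming (x ∷ xs) (y ∷ ys) = (if x xor y then 1 else 0) + hamming xs ys

Adjacent : ∀ {n} → Vertex n → Vertex n → Set
Adjacent u v = hamming u v ≡ 1

Disjoint : ∀ {n} → Vertex n × Vertex n → Vertex n × Vertex n → Set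
Disjoint (a , b) (c , d) = (a ≢ c) × (a ≢ d) × (b ≢ c) × (b ≢ d)

IsMatching : ∀ {n} → List (Vertex n × Vertex n) → Set
IsMatching {n} M =
  ((i : Fin (length M)) → Adjacent (proj₁ (L.lookup M i)) (proj₂ (L.lookup M i))) ×
  ((i j : Fin (length M)) → i ≢ j → Disjoint (L.lookup M i) (L.lookup M j))

-- a subcube pattern: nothing = free coordinate, just b = coordinate fixed to b
Pattern : ℕ → Set
Pattern n = Vec (Maybe Bool) n

freeCount : ∀ {n} → Pattern n → ℕ
freeCount [] = 0
freeCount (nothing ∷ p) = suc (freeCount p)
freeCount (just _ ∷ p) = freeCount p

IsSubcube : ∀ {n} → ℕ → Pattern n → Set
IsSubcube k p = freeCount p ≡ k

_∈C_ : ∀ {n} → Vertex n → Pattern n → Set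
_∈C_ {n} x p = (i : Fin n) (b : Bool) → lookup p i ≡ just b → lookup x i ≡ b

IsBreakerPairing : ∀ {n} → ℕ → List (Vertex n × Vertex n) → Set
IsBreakerPairing {n} k M =
  (p : Pattern n) → IsSubcube k p →
  ∃[ i ] (proj₁ (L.lookup M i) ∈C p × proj₂ (L.lookup M i) ∈C p)

HasPairingStrategy : ℕ → ℕ → Set
HasPairingStrategy n k =
  ∃[ M ] (IsMatching {n} M × IsBreakerPairing k M)

-- An edge lying in the face x₁ = 0 of Q_{n+1} is an edge of Q_n with a 0 prepended to both
-- endpoints, and a k-dimensional subcube of Q_n becomes a k-dimensional subcube of Q_{n+1} by
-- fixing x₁ = 0. Hence the edges of a Breaker pairing for Q(n+1,k) that lie in that face form a
-- Breaker pairing for Q(n,k); iterating this removes one coordinate at a time.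
module Submission where

open import Defs
open import Data.Nat using (ℕ; suc; _≤_; _>_; _≤′_; ≤′-refl; ≤′-step)
open import Data.Nat.Properties using (≤⇒≤′)
open import Data.Bool using (Bool; true; false)
open import Data.Maybe using (Maybe; just; nothing)
open import Data.Vec using (_∷_)
open import Data.Fin using (Fin; zero)
import Data.Fin as Fin
open import Data.Fin.Properties using (suc-injective)
open import Data.List using (List; length; []; _∷_; lookup; mapMaybe)
open import Data.Product using (_×_; _,_; ∃-syntax; proj₁; proj₂)
open import Function.Definitions using (Injective)
open import Relation.Binary.PropositionalEquality using (_≡_; _≢_; refl; cong; subst; subst₂; sym)

module _ {A B : Set} (f : A → Maybe B) where

  mapMaybe-index : (xs : List A) → Fin (length (mapMaybe f xs)) → Fin (length xs)
  mapMaybe-index (x ∷ xs) j with f x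
  mapMaybe-index (x ∷ xs) zero        | just _  = zero
  mapMaybe-index (x ∷ xs) (Fin.suc j) | just _  = Fin.suc (mapMaybe-index xs j)
  mapMaybe-index (x ∷ xs) j           | nothing = Fin.suc (mapMaybe-index xs j)

  mapMaybe-index-lookup : (xs : List A) (j : Fin (length (mapMaybe f xs))) →
                          f (lookup xs (mapMaybe-index xs j)) ≡ just (lookup (mapMaybe f xs) j)
  mapMaybe-index-lookup (x ∷ xs) j with f x in fx≡
  mapMaybe-index-lookup (x ∷ xs) zero        | just _  = fx≡
  mapMaybe-index-lookup (x ∷ xs) (Fin.suc j) | just _  = mapMaybe-index-lookup xs j
  mapMaybe-index-lookup (x ∷ xs) j           | nothing = mapMaybe-index-lookup xs j

  mapMaybe-index-injective : (xs : List A) → Injective _≡_ _≡_ (mapMaybe-index xs)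
  mapMaybe-index-injective (x ∷ xs) {i} {j} eq with f x
  mapMaybe-index-injective (x ∷ xs) {zero}      {zero}      eq | just _ = refl
  mapMaybe-index-injective (x ∷ xs) {Fin.suc i} {Fin.suc j} eq | just _ =
    cong Fin.suc (mapMaybe-index-injective xs (suc-injective eq))
  mapMaybe-index-injective (x ∷ xs) {i} {j} eq | nothing =
    mapMaybe-index-injective xs (suc-injective eq)

  lookup-mapMaybe⁺ : (xs : List A) (i : Fin (length xs)) {y : B} → f (lookup xs i) ≡ just y →
                     ∃[ j ] lookup (mapMaybe f xs) j ≡ y
  lookup-mapMaybe⁺ (x ∷ xs) zero        fx≡y rewrite fx≡y = zero , refl
  lookup-mapMaybe⁺ (x ∷ xs) (Fin.suc i) fxsᵢ≡y with f x
  ... | just _  = let j , eq = lookup-mapMaybe⁺ xs i fxsᵢ≡y in Fin.suc j , eq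
  ... | nothing = lookup-mapMaybe⁺ xs i fxsᵢ≡y

Edge : ℕ → Set
Edge n = Vertex n × Vertex n

_⊆C_ : ∀ {n} → Edge n → Pattern n → Set
e ⊆C p = proj₁ e ∈C p × proj₂ e ∈C p

liftEdge : ∀ {n} → Bool → Edge n → Edge (suc n)
liftEdge x (u , v) = x ∷ u , x ∷ v

adjacent-liftEdge⁻ : ∀ {n} x (e : Edge n) →
                     Adjacent (proj₁ (liftEdge x e)) (proj₂ (liftEdge x e)) → Adjacent (proj₁ e) (proj₂ e)
adjacent-liftEdge⁻ false _ adj = adj
adjacent-liftEdge⁻ true  _ adj = adj

disjoint-liftEdge⁻ : ∀ {n} x (e e′ : Edge n) → Disjoint (liftEdge x e) (liftEdge x e′) → Disjoint e e′
disjoint-liftEdge⁻ x _ _ (a≢c , a≢d , b≢c , b≢d) =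
  (λ eq → a≢c (cong (x ∷_) eq)) , (λ eq → a≢d (cong (x ∷_) eq)) ,
  (λ eq → b≢c (cong (x ∷_) eq)) , (λ eq → b≢d (cong (x ∷_) eq))

∈C-just⁻ : ∀ {n x b} {u : Vertex n} {p : Pattern n} → (x ∷ u) ∈C (just b ∷ p) → x ≡ b × u ∈C p
∈C-just⁻ u∈p = u∈p zero _ refl , λ i → u∈p (Fin.suc i)

faceEdge : ∀ {n} → Edge (suc n) → Maybe (Edge n)
faceEdge (false ∷ u , false ∷ v) = just (u , v)
faceEdge _                       = nothing

faceEdge-just : ∀ {n} (e : Edge (suc n)) {e′ : Edge n} → faceEdge e ≡ just e′ → e ≡ liftEdge false e′
faceEdge-just (false ∷ u , false ∷ v) refl = refl
faceEdge-just (false ∷ u , true ∷ v)  ()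
faceEdge-just (true ∷ u , _)          ()

faceEdge-⊆C : ∀ {n} (e : Edge (suc n)) {p : Pattern n} → e ⊆C (just false ∷ p) →
              ∃[ e′ ] faceEdge e ≡ just e′ × e′ ⊆C p
faceEdge-⊆C (x ∷ u , y ∷ v) (xu∈p , yv∈p) with ∈C-just⁻ xu∈p | ∈C-just⁻ yv∈p
... | refl , u∈p | refl , v∈p = (u , v) , refl , u∈p , v∈p

restrictToFace : ∀ {n} → List (Edge (suc n)) → List (Edge n)
restrictToFace = mapMaybe faceEdge

module _ {n : ℕ} (M : List (Edge (suc n))) where

  private
    M′ : List (Edge n)
    M′ = restrictToFace M

    ι : Fin (length M′) → Fin (length M)
    ι = mapMaybe-index faceEdge M

    lookup-ι : ∀ j → lookup M (ι j) ≡ liftEdge false (lookup M′ j)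
    lookup-ι j = faceEdge-just (lookup M (ι j)) (mapMaybe-index-lookup faceEdge M j)

  restrictToFace-isMatching : IsMatching M → IsMatching M′
  restrictToFace-isMatching (adjacent , disjoint) = adjacent′ , disjoint′
    where
    adjacent′ : ∀ j → Adjacent (proj₁ (lookup M′ j)) (proj₂ (lookup M′ j))
    adjacent′ j = adjacent-liftEdge⁻ false (lookup M′ j)
      (subst (λ e → Adjacent (proj₁ e) (proj₂ e)) (lookup-ι j) (adjacent (ι j)))

    disjoint′ : ∀ i j → i ≢ j → Disjoint (lookup M′ i) (lookup M′ j)
    disjoint′ i j i≢j = disjoint-liftEdge⁻ false (lookup M′ i) (lookup M′ j)
      (subst₂ Disjoint (lookup-ι i) (lookup-ι j)
        (disjoint (ι i) (ι j) (λ ιi≡ιj → i≢j (mapMaybe-index-injective faceEdge M ιi≡ιj))))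

  restrictToFace-isBreakerPairing : ∀ {k} → IsBreakerPairing k M → IsBreakerPairing k M′
  restrictToFace-isBreakerPairing breaker p p-dim-k
    with i , eᵢ⊆p ← breaker (just false ∷ p) p-dim-k
    with e′ , faceEᵢ≡e′ , e′⊆p ← faceEdge-⊆C (lookup M i) eᵢ⊆p
    with j , eⱼ≡e′ ← lookup-mapMaybe⁺ faceEdge M i faceEᵢ≡e′
    = j , subst (_⊆C p) (sym eⱼ≡e′) e′⊆p

hasPairingStrategy-suc⁻ : ∀ {n k} → HasPairingStrategy (suc n) k → HasPairingStrategy n k
hasPairingStrategy-suc⁻ (M , matching , breaker) =
  restrictToFace M , restrictToFace-isMatching M matching , restrictToFace-isBreakerPairing M breaker

hasPairingStrategy-mono : ∀ {n N k} → n ≤′ N → HasPairingStrategy N k → HasPairingStrategy n k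
hasPairingStrategy-mono ≤′-refl        strategy = strategy
hasPairingStrategy-mono (≤′-step n≤′N) strategy =
  hasPairingStrategy-mono n≤′N (hasPairingStrategy-suc⁻ strategy)

lemma8 : (N k : ℕ) → N > 0 → k > 0 → HasPairingStrategy N k →
    (n : ℕ) → n > 0 → n ≤ N → HasPairingStrategy n k
lemma8 N k _ _ strategy n _ n≤N = hasPairingStrategy-mono (≤⇒≤′ n≤N) strategy
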